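{- Let $(S,\mathcal{U})$ be a colored linear order and let $\{D_r\}_{r\in S}$ be a definable family of subsets $D_r\subseteq S^n$ which is uniformly bounded above in each coordinate (there is $d\in S$ with every coordinate of every element of every $D_r$ below $d$). Then there exist $r_0\in S$ and a finite partition of $\{r\in S: r\geq r_0\}$ into definable sets such that $D_r$ is constant as $r$ ranges over each piece.
   Context: A colored linear order is a linear order $S$ with a set $\mathcal{U}$ of unary predicates, viewed as a first-order structure in the language $\{<\}\cup\mathcal{U}$ (taken $\omega$-saturated); "definable" means definable with parameters in this structure. A definable family $\{D_r\}_{r\in S}$ means the fibres of a definable set $D\subseteq S\times S^n$. -}

module Defs where

open import Data.Nat using (ℕ; suc)
open import Data.Fin using (Fin)
open import Data.List using (List; []; _∷_; _++_)
open import Data.List.Membership.Propositional using (_∈_)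
open import Data.List.Relation.Unary.All using (All)
open import Data.Vec.Functional using (Vector) renaming (_∷_ to _∷ᵥ_)
open import Data.Product using (Σ; _×_; _,_; ∃)
open import Data.Sum using (_⊎_)
open import Data.Unit using (⊤)
open import Data.Empty using (⊥)
open import Relation.Nullary using (¬_)
open import Relation.Binary.PropositionalEquality using (_≡_)
open import Relation.Binary.Structures using (IsStrictTotalOrder)
open import Function.Bundles using (_⇔_)

record ColoredLinearOrder : Set₁ where
  field
    Carrier  : Set
    _<_      : Carrier → Carrier → Set
    isSTO    : IsStrictTotalOrder _≡_ _<_
    Color    : Set
    U        : Color → Carrier → Set

module _ (𝕊 : ColoredLinearOrder) where
  open ColoredLinearOrder 𝕊 renaming (Carrier to S)

  _≤_ : S → S → Set
  a ≤ b = (a < b) ⊎ (a ≡ b)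

  data Term (n : ℕ) : Set where
    var   : Fin n → Term n
    param : S → Term n

  -- First-order formulas in the language {<} ∪ 𝒰 with parameters from S,
  -- with n free variables (de Bruijn style).
  data Formula (n : ℕ) : Set where
    ⊤ᶠ ⊥ᶠ : Formula n
    _<ᶠ_ : Term n → Term n → Formula n
    _≈ᶠ_ : Term n → Term n → Formula n
    colᶠ : Color → Term n → Formula n
    ¬ᶠ_  : Formula n → Formula n
    _∧ᶠ_ _∨ᶠ_ _⇒ᶠ_ : Formula n → Formula n → Formula n
    ∀ᶠ ∃ᶠ : Formula (suc n) → Formula n

  evalT : ∀ {n} → Term n → Vector S n → S
  evalT (var i)   v = v i
  evalT (param s) v = s

  -- Tarski satisfaction (classical once excluded middle is assumed).
  Sat : ∀ {n} → Formula n → Vector S n → Set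
  Sat ⊤ᶠ v = ⊤
  Sat ⊥ᶠ v = ⊥
  Sat (s <ᶠ t) v = evalT s v < evalT t v
  Sat (s ≈ᶠ t) v = evalT s v ≡ evalT t v
  Sat (colᶠ c t) v = U c (evalT t v)
  Sat (¬ᶠ φ) v = ¬ Sat φ v
  Sat (φ ∧ᶠ ψ) v = Sat φ v × Sat ψ v
  Sat (φ ∨ᶠ ψ) v = Sat φ v ⊎ Sat ψ v
  Sat (φ ⇒ᶠ ψ) v = Sat φ v → Sat ψ v
  Sat (∀ᶠ φ) v = (s : S) → Sat φ (s ∷ᵥ v)
  Sat (∃ᶠ φ) v = Σ S λ s → Sat φ (s ∷ᵥ v)

  paramsT : ∀ {n} → Term n → List S
  paramsT (var i)   = []
  paramsT (param s) = s ∷ []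

  params : ∀ {n} → Formula n → List S
  params ⊤ᶠ = []
  params ⊥ᶠ = []
  params (s <ᶠ t) = paramsT s ++ paramsT t
  params (s ≈ᶠ t) = paramsT s ++ paramsT t
  params (colᶠ c t) = paramsT t
  params (¬ᶠ φ) = params φ
  params (φ ∧ᶠ ψ) = params φ ++ params ψ
  params (φ ∨ᶠ ψ) = params φ ++ params ψ
  params (φ ⇒ᶠ ψ) = params φ ++ params ψ
  params (∀ᶠ φ) = params φ
  params (∃ᶠ φ) = params φ

  OmegaSaturated : Set₁
  OmegaSaturated =
    (A : List S) (p : Formula 1 → Set) →
    (∀ φ → p φ → All (_∈ A) (params φ)) →
    ((Φ : List (Formula 1)) → All p Φ →
       Σ S λ s → All (λ φ → Sat φ (s ∷ᵥ (λ ()))) Φ) →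
    Σ S λ s → ∀ φ → p φ → Sat φ (s ∷ᵥ (λ ()))

  Definable : (k : ℕ) → (Vector S k → Set) → Set
  Definable k X = Σ (Formula k) λ φ → ∀ v → X v ⇔ Sat φ v

  -- A definable family {D_r}_{r∈S} of subsets of S^n:
  -- the fibres of a definable subset of S × S^n.
  DefinableFamily : (n : ℕ) → (S → Vector S n → Set) → Set
  DefinableFamily n D = Definable (suc n) (λ w → D (w Data.Fin.zero) (λ i → w (Data.Fin.suc i)))

  Definable₁ : (S → Set) → Set
  Definable₁ X = Definable 1 (λ w → X (w Data.Fin.zero))

-- Let φ(r, v) define the family, q its quantifier depth, and choose c above the
-- bound d and above every parameter of φ. If r, r′ > c are q-equivalent in the
-- back-and-forth game played inside (c, ∞) with the colors of φ and no
-- parameters, then copying every move ≤ c extends this to a q-round game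
-- between (r, v) and (r′, v) in S over the parameters of φ, for any v ≤ c; since
-- every tuple of every fibre lies below c, this gives D_r = D_r′. In a finite
-- language there are only finitely many q-classes (classically, by induction on
-- q), so r ↦ D_r takes finitely many values beyond c, and each piece
-- {r ≥ r₀ : D_r = D_s} is definable because the family is.
module Submission where

open import Defs
open import Level using (0ℓ)
open import Axiom.ExcludedMiddle using (ExcludedMiddle)
open import Data.Nat using (ℕ; zero; suc; _+_; _⊔_; s≤s) renaming (_≤_ to _≤ℕ_)
open import Data.Nat.Properties using (m≤m⊔n; m≤n⊔m; ≤-refl) renaming (≤-trans to ≤ℕ-trans)
open import Data.Fin using (Fin; _↑ˡ_; _↑ʳ_; splitAt; lift) renaming (zero to fzero; suc to fsuc)
open import Data.Vec.Functional using (Vector; head) renaming (_∷_ to _∷ᵥ_; [] to []ᵥ; _++_ to _++ᵥ_)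
open import Data.Vec.Functional.Properties using (∷-cong; lookup-++ˡ; lookup-++ʳ)
open import Data.List using (List; []; _∷_; _++_; concat; tabulate; map; length; lookup)
open import Data.List.Membership.Propositional using (_∈_)
open import Data.List.Membership.Propositional.Properties using (∈-++⁺ˡ; ∈-++⁺ʳ; ∈-map⁺)
open import Data.List.Relation.Unary.Any using (here; there)
open import Data.List.Relation.Unary.All using (All; []; _∷_) renaming (lookup to All-lookup; map to All-map; tabulate to All-tabulate)
open import Data.List.Relation.Unary.All.Properties using (++⁺; ++⁻ˡ; ++⁻ʳ; concat⁻; tabulate⁻; map⁺; map⁻)
open import Data.Product using (Σ; ∃-syntax; _×_; _,_; proj₁; proj₂)
open import Data.Product.Function.NonDependent.Propositional using (_×-⇔_)
open import Data.Sum using (inj₁; inj₂; [_,_]′)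
open import Data.Sum.Function.Propositional using (_⊎-⇔_)
open import Data.Unit using (⊤; tt)
open import Data.Empty using (⊥-elim)
open import Relation.Nullary using (¬_; yes; no)
open import Relation.Binary.Structures using (IsStrictTotalOrder)
open import Relation.Binary.Definitions using (Transitive; Trans; tri<; tri≈; tri>)
import Relation.Binary.Construct.StrictToNonStrict as NonStrict
open import Relation.Binary.PropositionalEquality using (_≡_; _≢_; _≗_; refl; sym; trans; cong)
open import Function using (_∘_; id)
open import Function.Bundles using (_⇔_; mk⇔; Equivalence)
open import Function.Properties.Equivalence using () renaming (refl to ⇔-refl; sym to ⇔-sym; trans to ⇔-trans)
open import Function.Related.TypeIsomorphisms using (→-cong-⇔; ¬-cong-⇔)

open Equivalence using (to; from)

Π-cong-⇔ : {A : Set} {B C : A → Set} → (∀ x → B x ⇔ C x) → (∀ x → B x) ⇔ (∀ x → C x)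
Π-cong-⇔ B⇔C = mk⇔ (λ f x → to (B⇔C x) (f x)) (λ g x → from (B⇔C x) (g x))

Σ-cong-⇔ : {A : Set} {B C : A → Set} → (∀ x → B x ⇔ C x) → Σ A B ⇔ Σ A C
Σ-cong-⇔ B⇔C = mk⇔ (λ (x , b) → x , to (B⇔C x) b) (λ (x , c) → x , from (B⇔C x) c)

⇔-cong-⇔ : {A A′ B B′ : Set} → A ⇔ A′ → B ⇔ B′ → (A ⇔ B) ⇔ (A′ ⇔ B′)
⇔-cong-⇔ a b = mk⇔ (λ e → ⇔-trans (⇔-sym a) (⇔-trans e b)) (λ e → ⇔-trans a (⇔-trans e (⇔-sym b)))

module _ {A : Set} where

  ⇔-cong : (P : A → Set) {x x′ : A} → x ≡ x′ → P x ⇔ P x′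
  ⇔-cong P refl = ⇔-refl

  ⇔-cong₂ : (R : A → A → Set) {x x′ y y′ : A} → x ≡ x′ → y ≡ y′ → R x y ⇔ R x′ y′
  ⇔-cong₂ R refl refl = ⇔-refl

  ⇔-transport : (P : A → Set) {x x′ z z′ : A} → x ≡ x′ → z ≡ z′ → P x′ ⇔ P z′ → P x ⇔ P z
  ⇔-transport P refl refl h = h

  ⇔-transport₂ : (R : A → A → Set) {x x′ y y′ z z′ w w′ : A} →
    x ≡ x′ → y ≡ y′ → z ≡ z′ → w ≡ w′ → R x′ y′ ⇔ R z′ w′ → R x y ⇔ R z w
  ⇔-transport₂ R refl refl refl refl h = h

++-uncons : ∀ {A : Set} {m n} (u : Vector A (suc m)) (w : Vector A n) → u ++ᵥ w ≗ u fzero ∷ᵥ (u ∘ fsuc ++ᵥ w)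
++-uncons u w fzero = refl
++-uncons {m = m} u w (fsuc i) with splitAt m i
... | inj₁ j = refl
... | inj₂ j = refl

∷⁺ : ∀ {A : Set} (P : A → Set) {n x} {u : Vector A n} → P x → (∀ i → P (u i)) → ∀ i → P ((x ∷ᵥ u) i)
∷⁺ P px pu fzero = px
∷⁺ P px pu (fsuc i) = pu i

module Order (𝕊 : ColoredLinearOrder) where
  open ColoredLinearOrder 𝕊 renaming (Carrier to S)
  open IsStrictTotalOrder isSTO public using (compare) renaming (trans to <-trans; irrefl to <-irrefl; asym to <-asym)
  open IsStrictTotalOrder isSTO using (module Eq; isEquivalence; <-resp-≈; <-respˡ-≈; <-respʳ-≈)
  private module N = NonStrict _≡_ _<_

  ≤-trans : Transitive (_≤_ 𝕊)
  ≤-trans = N.trans isEquivalence <-resp-≈ <-trans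

  ≤-<-trans : Trans (_≤_ 𝕊) _<_ _<_
  ≤-<-trans = N.≤-<-trans Eq.sym <-trans <-respˡ-≈

  <-≤-trans : Trans _<_ (_≤_ 𝕊) _<_
  <-≤-trans = N.<-≤-trans <-trans <-respʳ-≈

  ≤-<⇒≢ : ∀ {a b d} → _≤_ 𝕊 a b → b < d → a ≢ d
  ≤-<⇒≢ a≤b b<d refl = <-irrefl refl (≤-<-trans a≤b b<d)

  upperBound : (d : S) (ps : List S) → ∃[ c ] _≤_ 𝕊 d c × All (λ p → _≤_ 𝕊 p c) ps
  upperBound d [] = d , inj₂ refl , []
  upperBound d (p ∷ ps) with upperBound d ps
  ... | c , d≤c , ps≤c with compare p c
  ... | tri< p<c _ _ = c , d≤c , inj₁ p<c ∷ ps≤c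
  ... | tri≈ _ p≡c _ = c , d≤c , inj₂ p≡c ∷ ps≤c
  ... | tri> _ _ c<p =
    p , ≤-trans d≤c (inj₁ c<p) , inj₂ refl ∷ All-map (λ q≤c → ≤-trans q≤c (inj₁ c<p)) ps≤c

module Semantics (𝕊 : ColoredLinearOrder) where
  open ColoredLinearOrder 𝕊 renaming (Carrier to S)

  evalT-cong : ∀ {N} (t : Term 𝕊 N) {v v′ : Vector S N} → v ≗ v′ → evalT 𝕊 t v ≡ evalT 𝕊 t v′
  evalT-cong (var i) e = e i
  evalT-cong (param s) e = refl

  Sat-cong : ∀ {N} (φ : Formula 𝕊 N) {v v′ : Vector S N} → v ≗ v′ → Sat 𝕊 φ v ⇔ Sat 𝕊 φ v′
  Sat-cong ⊤ᶠ e = ⇔-refl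
  Sat-cong ⊥ᶠ e = ⇔-refl
  Sat-cong (s <ᶠ t) e = ⇔-cong₂ _<_ (evalT-cong s e) (evalT-cong t e)
  Sat-cong (s ≈ᶠ t) e = ⇔-cong₂ _≡_ (evalT-cong s e) (evalT-cong t e)
  Sat-cong (colᶠ c t) e = ⇔-cong (U c) (evalT-cong t e)
  Sat-cong (¬ᶠ φ) e = ¬-cong-⇔ (Sat-cong φ e)
  Sat-cong (φ ∧ᶠ ψ) e = Sat-cong φ e ×-⇔ Sat-cong ψ e
  Sat-cong (φ ∨ᶠ ψ) e = Sat-cong φ e ⊎-⇔ Sat-cong ψ e
  Sat-cong (φ ⇒ᶠ ψ) e = →-cong-⇔ (Sat-cong φ e) (Sat-cong ψ e)
  Sat-cong (∀ᶠ φ) e = Π-cong-⇔ λ s → Sat-cong φ (∷-cong refl e)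
  Sat-cong (∃ᶠ φ) e = Σ-cong-⇔ λ s → Sat-cong φ (∷-cong refl e)

  renT : ∀ {N K} → (Fin N → Fin K) → Term 𝕊 N → Term 𝕊 K
  renT ρ (var i) = var (ρ i)
  renT ρ (param s) = param s

  evalT-ren : ∀ {N K} (ρ : Fin N → Fin K) (t : Term 𝕊 N) {a : Vector S K} {a′ : Vector S N} →
    a′ ≗ a ∘ ρ → evalT 𝕊 t a′ ≡ evalT 𝕊 (renT ρ t) a
  evalT-ren ρ (var i) e = e i
  evalT-ren ρ (param s) e = refl

  Substitution : ℕ → ℕ → Set
  Substitution N K = Fin N → Term 𝕊 K

  liftₛ : ∀ {N K} → Substitution N K → Substitution (suc N) (suc K)
  liftₛ σ fzero = var fzero
  liftₛ σ (fsuc i) = renT fsuc (σ i)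

  subT : ∀ {N K} → Substitution N K → Term 𝕊 N → Term 𝕊 K
  subT σ (var i) = σ i
  subT σ (param s) = param s

  sub : ∀ {N K} → Substitution N K → Formula 𝕊 N → Formula 𝕊 K
  sub σ ⊤ᶠ = ⊤ᶠ
  sub σ ⊥ᶠ = ⊥ᶠ
  sub σ (s <ᶠ t) = subT σ s <ᶠ subT σ t
  sub σ (s ≈ᶠ t) = subT σ s ≈ᶠ subT σ t
  sub σ (colᶠ c t) = colᶠ c (subT σ t)
  sub σ (¬ᶠ φ) = ¬ᶠ sub σ φ
  sub σ (φ ∧ᶠ ψ) = sub σ φ ∧ᶠ sub σ ψ
  sub σ (φ ∨ᶠ ψ) = sub σ φ ∨ᶠ sub σ ψ
  sub σ (φ ⇒ᶠ ψ) = sub σ φ ⇒ᶠ sub σ ψ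
  sub σ (∀ᶠ φ) = ∀ᶠ (sub (liftₛ σ) φ)
  sub σ (∃ᶠ φ) = ∃ᶠ (sub (liftₛ σ) φ)

  _⊨ₛ_⇒_ : ∀ {N K} → Vector S K → Substitution N K → Vector S N → Set
  v ⊨ₛ σ ⇒ w = ∀ i → evalT 𝕊 (σ i) v ≡ w i

  evalT-sub : ∀ {N K} (σ : Substitution N K) (t : Term 𝕊 N) {v w} → v ⊨ₛ σ ⇒ w →
    evalT 𝕊 (subT σ t) v ≡ evalT 𝕊 t w
  evalT-sub σ (var i) e = e i
  evalT-sub σ (param s) e = refl

  liftₛ-⊨ : ∀ {N K} (σ : Substitution N K) (s : S) {v w} → v ⊨ₛ σ ⇒ w →
    (s ∷ᵥ v) ⊨ₛ liftₛ σ ⇒ (s ∷ᵥ w)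
  liftₛ-⊨ σ s e fzero = refl
  liftₛ-⊨ σ s e (fsuc i) = trans (sym (evalT-ren fsuc (σ i) λ _ → refl)) (e i)

  Sat-sub : ∀ {N K} (σ : Substitution N K) (φ : Formula 𝕊 N) {v w} → v ⊨ₛ σ ⇒ w →
    Sat 𝕊 (sub σ φ) v ⇔ Sat 𝕊 φ w
  Sat-sub σ ⊤ᶠ e = ⇔-refl
  Sat-sub σ ⊥ᶠ e = ⇔-refl
  Sat-sub σ (s <ᶠ t) e = ⇔-cong₂ _<_ (evalT-sub σ s e) (evalT-sub σ t e)
  Sat-sub σ (s ≈ᶠ t) e = ⇔-cong₂ _≡_ (evalT-sub σ s e) (evalT-sub σ t e)
  Sat-sub σ (colᶠ c t) e = ⇔-cong (U c) (evalT-sub σ t e)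
  Sat-sub σ (¬ᶠ φ) e = ¬-cong-⇔ (Sat-sub σ φ e)
  Sat-sub σ (φ ∧ᶠ ψ) e = Sat-sub σ φ e ×-⇔ Sat-sub σ ψ e
  Sat-sub σ (φ ∨ᶠ ψ) e = Sat-sub σ φ e ⊎-⇔ Sat-sub σ ψ e
  Sat-sub σ (φ ⇒ᶠ ψ) e = →-cong-⇔ (Sat-sub σ φ e) (Sat-sub σ ψ e)
  Sat-sub σ (∀ᶠ φ) e = Π-cong-⇔ λ s → Sat-sub (liftₛ σ) φ (liftₛ-⊨ σ s e)
  Sat-sub σ (∃ᶠ φ) e = Σ-cong-⇔ λ s → Sat-sub (liftₛ σ) φ (liftₛ-⊨ σ s e)

  _⇔ᶠ_ : ∀ {N} → Formula 𝕊 N → Formula 𝕊 N → Formula 𝕊 N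
  φ ⇔ᶠ ψ = (φ ⇒ᶠ ψ) ∧ᶠ (ψ ⇒ᶠ φ)

  Sat-⇔ᶠ : ∀ {N} (φ ψ : Formula 𝕊 N) (v : Vector S N) → Sat 𝕊 (φ ⇔ᶠ ψ) v ⇔ (Sat 𝕊 φ v ⇔ Sat 𝕊 ψ v)
  Sat-⇔ᶠ φ ψ v = mk⇔ (λ (f , g) → mk⇔ f g) (λ e → to e , from e)

  ∀ⁿ : ∀ n {m} → Formula 𝕊 (n + m) → Formula 𝕊 m
  ∀ⁿ zero ψ = ψ
  ∀ⁿ (suc n) ψ = ∀ⁿ n (∀ᶠ ψ)

  Sat-∀ⁿ : ∀ n {m} (ψ : Formula 𝕊 (n + m)) (v : Vector S m) →
    Sat 𝕊 (∀ⁿ n ψ) v ⇔ (∀ w → Sat 𝕊 ψ (w ++ᵥ v))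
  Sat-∀ⁿ zero ψ v = mk⇔ (λ h w → h) (λ h → h []ᵥ)
  Sat-∀ⁿ (suc n) ψ v = ⇔-trans (Sat-∀ⁿ n (∀ᶠ ψ) v) (mk⇔
    (λ h w → from (Sat-cong ψ (++-uncons w v)) (h (w ∘ fsuc) (w fzero)))
    (λ h w s → to (Sat-cong ψ (++-uncons (s ∷ᵥ w) v)) (h (s ∷ᵥ w))))

module EhrenfeuchtFraisse (𝕊 : ColoredLinearOrder) where
  open ColoredLinearOrder 𝕊 renaming (Carrier to S)
  open Semantics 𝕊 using (renT; evalT-ren)

  module Game (C : List Color) (Dom : S → Set) (P : List S) where

    Admissible : ∀ {N} → Term 𝕊 N → Set
    Admissible t = All (_∈ P) (paramsT 𝕊 t)

    renT-admissible : ∀ {N K} (ρ : Fin N → Fin K) (t : Term 𝕊 N) → Admissible t → Admissible (renT ρ t)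
    renT-admissible ρ (var i) _ = []
    renT-admissible ρ (param s) adm = adm

    record AtomEquiv {N} (a b : Vector S N) : Set where
      field
        <-⇔ : ∀ s t → Admissible s → Admissible t →
          (evalT 𝕊 s a < evalT 𝕊 t a) ⇔ (evalT 𝕊 s b < evalT 𝕊 t b)
        ≡-⇔ : ∀ s t → Admissible s → Admissible t →
          (evalT 𝕊 s a ≡ evalT 𝕊 t a) ⇔ (evalT 𝕊 s b ≡ evalT 𝕊 t b)
        U-⇔ : ∀ c → c ∈ C → ∀ t → Admissible t → U c (evalT 𝕊 t a) ⇔ U c (evalT 𝕊 t b)
    open AtomEquiv public

    EF : ℕ → ∀ {N} → Vector S N → Vector S N → Set
    EF zero a b = AtomEquiv a b
    EF (suc q) a b = AtomEquiv a b
      × (∀ x → Dom x → ∃[ y ] Dom y × EF q (x ∷ᵥ a) (y ∷ᵥ b))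
      × (∀ y → Dom y → ∃[ x ] Dom x × EF q (x ∷ᵥ a) (y ∷ᵥ b))

    EF⇒AtomEquiv : ∀ q {N} {a b : Vector S N} → EF q a b → AtomEquiv a b
    EF⇒AtomEquiv zero g = g
    EF⇒AtomEquiv (suc q) (at , _) = at

    EF-suc⇒EF : ∀ q {N} {a b : Vector S N} → EF (suc q) a b → EF q a b
    EF-suc⇒EF zero (at , _) = at
    EF-suc⇒EF (suc q) (at , forth , back) =
      at ,
      (λ x dx → let y , dy , g = forth x dx in y , dy , EF-suc⇒EF q g) ,
      (λ y dy → let x , dx , g = back y dy in x , dx , EF-suc⇒EF q g)

    AtomEquiv-sym : ∀ {N} {a b : Vector S N} → AtomEquiv a b → AtomEquiv b a
    AtomEquiv-sym at = record
      { <-⇔ = λ s t as at′ → ⇔-sym (<-⇔ at s t as at′)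
      ; ≡-⇔ = λ s t as at′ → ⇔-sym (≡-⇔ at s t as at′)
      ; U-⇔ = λ c c∈C t adm → ⇔-sym (U-⇔ at c c∈C t adm)
      }

    AtomEquiv-trans : ∀ {N} {a b d : Vector S N} → AtomEquiv a b → AtomEquiv b d → AtomEquiv a d
    AtomEquiv-trans ab bd = record
      { <-⇔ = λ s t as at → ⇔-trans (<-⇔ ab s t as at) (<-⇔ bd s t as at)
      ; ≡-⇔ = λ s t as at → ⇔-trans (≡-⇔ ab s t as at) (≡-⇔ bd s t as at)
      ; U-⇔ = λ c c∈C t adm → ⇔-trans (U-⇔ ab c c∈C t adm) (U-⇔ bd c c∈C t adm)
      }

    EF-sym : ∀ q {N} {a b : Vector S N} → EF q a b → EF q b a
    EF-sym zero g = AtomEquiv-sym g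
    EF-sym (suc q) (at , forth , back) =
      AtomEquiv-sym at ,
      (λ x dx → let y , dy , g = back x dx in y , dy , EF-sym q g) ,
      (λ y dy → let x , dx , g = forth y dy in x , dx , EF-sym q g)

    EF-trans : ∀ q {N} {a b d : Vector S N} → EF q a b → EF q b d → EF q a d
    EF-trans zero g h = AtomEquiv-trans g h
    EF-trans (suc q) (at , forth , back) (at′ , forth′ , back′) =
      AtomEquiv-trans at at′ ,
      (λ x dx → let y , dy , g = forth x dx ; z , dz , h = forth′ y dy in z , dz , EF-trans q g h) ,
      (λ z dz → let y , dy , h = back′ z dz ; x , dx , g = back y dy in x , dx , EF-trans q g h)

    AtomEquiv-reindex : ∀ {N K} (ρ : Fin N → Fin K) {a b : Vector S K} {a′ b′ : Vector S N} →
      a′ ≗ a ∘ ρ → b′ ≗ b ∘ ρ → AtomEquiv a b → AtomEquiv a′ b′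
    AtomEquiv-reindex ρ ea eb at = record
      { <-⇔ = λ s t as at′ → ⇔-transport₂ _<_
                (evalT-ren ρ s ea) (evalT-ren ρ t ea) (evalT-ren ρ s eb) (evalT-ren ρ t eb)
                (<-⇔ at (renT ρ s) (renT ρ t) (renT-admissible ρ s as) (renT-admissible ρ t at′))
      ; ≡-⇔ = λ s t as at′ → ⇔-transport₂ _≡_
                (evalT-ren ρ s ea) (evalT-ren ρ t ea) (evalT-ren ρ s eb) (evalT-ren ρ t eb)
                (≡-⇔ at (renT ρ s) (renT ρ t) (renT-admissible ρ s as) (renT-admissible ρ t at′))
      ; U-⇔ = λ c c∈C t adm → ⇔-transport (U c) (evalT-ren ρ t ea) (evalT-ren ρ t eb)
                (U-⇔ at c c∈C (renT ρ t) (renT-admissible ρ t adm))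
      }

    EF-reindex : ∀ q {N K} (ρ : Fin N → Fin K) {a b : Vector S K} {a′ b′ : Vector S N} →
      a′ ≗ a ∘ ρ → b′ ≗ b ∘ ρ → EF q a b → EF q a′ b′
    EF-reindex zero ρ ea eb g = AtomEquiv-reindex ρ ea eb g
    EF-reindex (suc q) ρ ea eb (at , forth , back) =
      AtomEquiv-reindex ρ ea eb at ,
      (λ x dx → let y , dy , g = forth x dx in
        y , dy , EF-reindex q (lift 1 ρ) (∷-cong refl ea) (∷-cong refl eb) g) ,
      (λ y dy → let x , dx , g = back y dy in
        x , dx , EF-reindex q (lift 1 ρ) (∷-cong refl ea) (∷-cong refl eb) g)

  depth : ∀ {N} → Formula 𝕊 N → ℕ
  depth (¬ᶠ φ) = depth φ
  depth (φ ∧ᶠ ψ) = depth φ ⊔ depth ψ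
  depth (φ ∨ᶠ ψ) = depth φ ⊔ depth ψ
  depth (φ ⇒ᶠ ψ) = depth φ ⊔ depth ψ
  depth (∀ᶠ φ) = suc (depth φ)
  depth (∃ᶠ φ) = suc (depth φ)
  depth _ = 0

  colors : ∀ {N} → Formula 𝕊 N → List Color
  colors (colᶠ c t) = c ∷ []
  colors (¬ᶠ φ) = colors φ
  colors (φ ∧ᶠ ψ) = colors φ ++ colors ψ
  colors (φ ∨ᶠ ψ) = colors φ ++ colors ψ
  colors (φ ⇒ᶠ ψ) = colors φ ++ colors ψ
  colors (∀ᶠ φ) = colors φ
  colors (∃ᶠ φ) = colors φ
  colors _ = []

  module _ (C : List Color) (P : List S) where
    open Game C (λ _ → ⊤) P

    EF-preserves-Sat : ∀ {N} (φ : Formula 𝕊 N) → All (_∈ P) (params 𝕊 φ) → All (_∈ C) (colors φ) →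
      ∀ q → depth φ ≤ℕ q → ∀ {a b : Vector S N} → EF q a b → Sat 𝕊 φ a ⇔ Sat 𝕊 φ b
    private
      Sat-⇔ˡ : ∀ {N} (φ ψ : Formula 𝕊 N) → All (_∈ P) (params 𝕊 φ ++ params 𝕊 ψ) →
        All (_∈ C) (colors φ ++ colors ψ) → ∀ q → depth φ ⊔ depth ψ ≤ℕ q →
        ∀ {a b : Vector S N} → EF q a b → Sat 𝕊 φ a ⇔ Sat 𝕊 φ b
      Sat-⇔ˡ φ ψ ps cs q dq =
        EF-preserves-Sat φ (++⁻ˡ (params 𝕊 φ) ps) (++⁻ˡ (colors φ) cs) q (≤ℕ-trans (m≤m⊔n _ _) dq)

      Sat-⇔ʳ : ∀ {N} (φ ψ : Formula 𝕊 N) → All (_∈ P) (params 𝕊 φ ++ params 𝕊 ψ) →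
        All (_∈ C) (colors φ ++ colors ψ) → ∀ q → depth φ ⊔ depth ψ ≤ℕ q →
        ∀ {a b : Vector S N} → EF q a b → Sat 𝕊 ψ a ⇔ Sat 𝕊 ψ b
      Sat-⇔ʳ φ ψ ps cs q dq =
        EF-preserves-Sat ψ (++⁻ʳ (params 𝕊 φ) ps) (++⁻ʳ (colors φ) cs) q (≤ℕ-trans (m≤n⊔m _ _) dq)

    EF-preserves-Sat ⊤ᶠ _ _ q _ g = ⇔-refl
    EF-preserves-Sat ⊥ᶠ _ _ q _ g = ⇔-refl
    EF-preserves-Sat (s <ᶠ t) ps _ q _ g =
      <-⇔ (EF⇒AtomEquiv q g) s t (++⁻ˡ (paramsT 𝕊 s) ps) (++⁻ʳ (paramsT 𝕊 s) ps)
    EF-preserves-Sat (s ≈ᶠ t) ps _ q _ g =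
      ≡-⇔ (EF⇒AtomEquiv q g) s t (++⁻ˡ (paramsT 𝕊 s) ps) (++⁻ʳ (paramsT 𝕊 s) ps)
    EF-preserves-Sat (colᶠ c t) ps (c∈C ∷ []) q _ g = U-⇔ (EF⇒AtomEquiv q g) c c∈C t ps
    EF-preserves-Sat (¬ᶠ φ) ps cs q dq g = ¬-cong-⇔ (EF-preserves-Sat φ ps cs q dq g)
    EF-preserves-Sat (φ ∧ᶠ ψ) ps cs q dq g = Sat-⇔ˡ φ ψ ps cs q dq g ×-⇔ Sat-⇔ʳ φ ψ ps cs q dq g
    EF-preserves-Sat (φ ∨ᶠ ψ) ps cs q dq g = Sat-⇔ˡ φ ψ ps cs q dq g ⊎-⇔ Sat-⇔ʳ φ ψ ps cs q dq g
    EF-preserves-Sat (φ ⇒ᶠ ψ) ps cs q dq g = →-cong-⇔ (Sat-⇔ˡ φ ψ ps cs q dq g) (Sat-⇔ʳ φ ψ ps cs q dq g)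
    EF-preserves-Sat (∀ᶠ φ) ps cs (suc q) (s≤s dq) (_ , forth , back) = mk⇔
      (λ h y → let x , _ , g = back y tt in to (EF-preserves-Sat φ ps cs q dq g) (h x))
      (λ h x → let y , _ , g = forth x tt in from (EF-preserves-Sat φ ps cs q dq g) (h y))
    EF-preserves-Sat (∃ᶠ φ) ps cs (suc q) (s≤s dq) (_ , forth , back) = mk⇔
      (λ (x , h) → let y , _ , g = forth x tt in y , to (EF-preserves-Sat φ ps cs q dq g) h)
      (λ (y , h) → let x , _ , g = back y tt in x , from (EF-preserves-Sat φ ps cs q dq g) h)


module Composition (𝕊 : ColoredLinearOrder) (C : List (ColoredLinearOrder.Color 𝕊))
  (P : List (ColoredLinearOrder.Carrier 𝕊)) (c : ColoredLinearOrder.Carrier 𝕊)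
  (P≤c : All (λ p → _≤_ 𝕊 p c) P) where
  open ColoredLinearOrder 𝕊 renaming (Carrier to S)
  open Order 𝕊
  open EhrenfeuchtFraisse 𝕊
  module F = Game C (λ _ → ⊤) P
  module R = Game C (c <_) []

  module _ {k m} (u u′ : Vector S k) (w : Vector S m) (c<u : ∀ i → c < u i) (c<u′ : ∀ i → c < u′ i)
           (w≤c : ∀ i → _≤_ 𝕊 (w i) c) where

    data Value (t : Term 𝕊 (k + m)) : Set where
      low  : (l : S) → _≤_ 𝕊 l c → evalT 𝕊 t (u ++ᵥ w) ≡ l → evalT 𝕊 t (u′ ++ᵥ w) ≡ l → Value t
      high : (j : Fin k) → evalT 𝕊 t (u ++ᵥ w) ≡ u j → evalT 𝕊 t (u′ ++ᵥ w) ≡ u′ j → Value t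

    value : (t : Term 𝕊 (k + m)) → F.Admissible t → Value t
    value (param s) (s∈P ∷ []) = low s (All-lookup P≤c s∈P) refl refl
    value (var i) _ with splitAt k i in eq
    ... | inj₁ j = high j (cong [ u , w ]′ eq) (cong [ u′ , w ]′ eq)
    ... | inj₂ j = low (w j) (w≤c j) (cong [ u , w ]′ eq) (cong [ u′ , w ]′ eq)

    module _ (u≈u′ : R.AtomEquiv u u′) where
      value-< : ∀ {s t} → Value s → Value t →
        (evalT 𝕊 s (u ++ᵥ w) < evalT 𝕊 t (u ++ᵥ w)) ⇔ (evalT 𝕊 s (u′ ++ᵥ w) < evalT 𝕊 t (u′ ++ᵥ w))
      value-< (low l _ e₁ e₂) (low l′ _ e₁′ e₂′) = ⇔-transport₂ _<_ e₁ e₁′ e₂ e₂′ ⇔-refl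
      value-< (low l l≤c e₁ e₂) (high j e₁′ e₂′) = ⇔-transport₂ _<_ e₁ e₁′ e₂ e₂′
        (mk⇔ (λ _ → ≤-<-trans l≤c (c<u′ j)) (λ _ → ≤-<-trans l≤c (c<u j)))
      value-< (high j e₁ e₂) (low l l≤c e₁′ e₂′) = ⇔-transport₂ _<_ e₁ e₁′ e₂ e₂′
        (mk⇔ (λ u<l → ⊥-elim (<-asym u<l (≤-<-trans l≤c (c<u j))))
             (λ u<l → ⊥-elim (<-asym u<l (≤-<-trans l≤c (c<u′ j)))))
      value-< (high j e₁ e₂) (high j′ e₁′ e₂′) = ⇔-transport₂ _<_ e₁ e₁′ e₂ e₂′
        (R.<-⇔ u≈u′ (var j) (var j′) [] [])

      value-≡ : ∀ {s t} → Value s → Value t →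
        (evalT 𝕊 s (u ++ᵥ w) ≡ evalT 𝕊 t (u ++ᵥ w)) ⇔ (evalT 𝕊 s (u′ ++ᵥ w) ≡ evalT 𝕊 t (u′ ++ᵥ w))
      value-≡ (low l _ e₁ e₂) (low l′ _ e₁′ e₂′) = ⇔-transport₂ _≡_ e₁ e₁′ e₂ e₂′ ⇔-refl
      value-≡ (low l l≤c e₁ e₂) (high j e₁′ e₂′) = ⇔-transport₂ _≡_ e₁ e₁′ e₂ e₂′
        (mk⇔ (⊥-elim ∘ ≤-<⇒≢ l≤c (c<u j)) (⊥-elim ∘ ≤-<⇒≢ l≤c (c<u′ j)))
      value-≡ (high j e₁ e₂) (low l l≤c e₁′ e₂′) = ⇔-transport₂ _≡_ e₁ e₁′ e₂ e₂′
        (mk⇔ (⊥-elim ∘ ≤-<⇒≢ l≤c (c<u j) ∘ sym) (⊥-elim ∘ ≤-<⇒≢ l≤c (c<u′ j) ∘ sym))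
      value-≡ (high j e₁ e₂) (high j′ e₁′ e₂′) = ⇔-transport₂ _≡_ e₁ e₁′ e₂ e₂′
        (R.≡-⇔ u≈u′ (var j) (var j′) [] [])

      value-U : ∀ {t} col → col ∈ C → Value t →
        U col (evalT 𝕊 t (u ++ᵥ w)) ⇔ U col (evalT 𝕊 t (u′ ++ᵥ w))
      value-U col _ (low l _ e₁ e₂) = ⇔-transport (U col) e₁ e₂ ⇔-refl
      value-U col col∈C (high j e₁ e₂) = ⇔-transport (U col) e₁ e₂ (R.U-⇔ u≈u′ col col∈C (var j) [])

      AtomEquiv-++ : F.AtomEquiv (u ++ᵥ w) (u′ ++ᵥ w)
      AtomEquiv-++ = record
        { <-⇔ = λ s t as at → value-< (value s as) (value t at)
        ; ≡-⇔ = λ s t as at → value-≡ (value s as) (value t at)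
        ; U-⇔ = λ col col∈C t adm → value-U col col∈C (value t adm)
        }

  insertLow : ∀ k m → Fin (suc (k + m)) → Fin (k + suc m)
  insertLow k m fzero = k ↑ʳ fzero
  insertLow k m (fsuc i) = [ _↑ˡ suc m , (λ j → k ↑ʳ fsuc j) ]′ (splitAt k i)

  insertLow-≗ : ∀ {k m} (x : S) (u : Vector S k) (w : Vector S m) →
    x ∷ᵥ (u ++ᵥ w) ≗ (u ++ᵥ (x ∷ᵥ w)) ∘ insertLow k m
  insertLow-≗ {k} x u w fzero = sym (lookup-++ʳ u (x ∷ᵥ w) fzero)
  insertLow-≗ {k} x u w (fsuc i) with splitAt k i
  ... | inj₁ j = sym (lookup-++ˡ u (x ∷ᵥ w) j)
  ... | inj₂ j = sym (lookup-++ʳ u (x ∷ᵥ w) (fsuc j))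

  -- Moves below c are copied, moves above c are answered by the strategy for u and u′.
  EF-++ : ∀ q {k m} (u u′ : Vector S k) (w : Vector S m) → (∀ i → c < u i) → (∀ i → c < u′ i) →
    (∀ i → _≤_ 𝕊 (w i) c) → R.EF q u u′ → F.EF q (u ++ᵥ w) (u′ ++ᵥ w)
  EF-++ zero u u′ w c<u c<u′ w≤c g = AtomEquiv-++ u u′ w c<u c<u′ w≤c g
  EF-++ (suc q) {k} {m} u u′ w c<u c<u′ w≤c g =
    AtomEquiv-++ u u′ w c<u c<u′ w≤c (proj₁ g) ,
    (λ x _ → let y , h = respond u u′ c<u c<u′ g x in y , tt , h) ,
    (λ y _ → let x , h = respond u′ u c<u′ c<u (R.EF-sym (suc q) g) y in x , tt , F.EF-sym q h)
    where
    copy : ∀ x (u u′ : Vector S k) → (∀ i → c < u i) → (∀ i → c < u′ i) → R.EF (suc q) u u′ →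
      _≤_ 𝕊 x c → F.EF q (x ∷ᵥ (u ++ᵥ w)) (x ∷ᵥ (u′ ++ᵥ w))
    copy x u u′ c<u c<u′ g x≤c = F.EF-reindex q (insertLow k m) (insertLow-≗ x u w) (insertLow-≗ x u′ w)
      (EF-++ q u u′ (x ∷ᵥ w) c<u c<u′ (∷⁺ (λ z → _≤_ 𝕊 z c) x≤c w≤c) (R.EF-suc⇒EF q g))

    respond : (u u′ : Vector S k) → (∀ i → c < u i) → (∀ i → c < u′ i) → R.EF (suc q) u u′ →
      ∀ x → ∃[ y ] F.EF q (x ∷ᵥ (u ++ᵥ w)) (y ∷ᵥ (u′ ++ᵥ w))
    respond u u′ c<u c<u′ g x with compare x c
    ... | tri< x<c _ _ = x , copy x u u′ c<u c<u′ g (inj₁ x<c)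
    ... | tri≈ _ x≡c _ = x , copy x u u′ c<u c<u′ g (inj₂ x≡c)
    ... | tri> _ _ c<x =
      let y , c<y , h = proj₁ (proj₂ g) x c<x in
      y , F.EF-reindex q id (sym ∘ ++-uncons (x ∷ᵥ u) w) (sym ∘ ++-uncons (y ∷ᵥ u′) w)
            (EF-++ q (x ∷ᵥ u) (y ∷ᵥ u′) w (∷⁺ (c <_) c<x c<u) (∷⁺ (c <_) c<y c<u′) w≤c h)

module FiniteIndex (em : ExcludedMiddle 0ℓ) where

  representatives : {X : Set} (fs : List (X → Set)) (Pr : X → Set) →
    ∃[ L ] All Pr L × (∀ x → Pr x → ∃[ y ] y ∈ L × All (λ f → f x ⇔ f y) fs)
  representatives {X} [] Pr with em {Σ X Pr}
  ... | yes (x₀ , px₀) = x₀ ∷ [] , px₀ ∷ [] , λ _ _ → x₀ , here refl , []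
  ... | no ∄x = [] , [] , λ x px → ⊥-elim (∄x (x , px))
  representatives (f ∷ fs) Pr
    with representatives fs (λ x → Pr x × f x) | representatives fs (λ x → Pr x × ¬ f x)
  ... | L₁ , Pr₁ , covers₁ | L₂ , Pr₂ , covers₂ =
    L₁ ++ L₂ , ++⁺ (All-map proj₁ Pr₁) (All-map proj₁ Pr₂) , covers
    where
    covers : ∀ x → Pr x → ∃[ y ] y ∈ L₁ ++ L₂ × All (λ g → g x ⇔ g y) (f ∷ fs)
    covers x px with em {f x}
    ... | yes fx = let y , y∈L₁ , same = covers₁ x (px , fx) in
      y , ∈-++⁺ˡ y∈L₁ , mk⇔ (λ _ → proj₂ (All-lookup Pr₁ y∈L₁)) (λ _ → fx) ∷ same
    ... | no ¬fx = let y , y∈L₂ , same = covers₂ x (px , ¬fx) in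
      y , ∈-++⁺ʳ L₁ y∈L₂ , mk⇔ (⊥-elim ∘ ¬fx) (⊥-elim ∘ proj₂ (All-lookup Pr₂ y∈L₂)) ∷ same

  module _ (𝕊 : ColoredLinearOrder) (C : List (ColoredLinearOrder.Color 𝕊))
           (c : ColoredLinearOrder.Carrier 𝕊) where
    open ColoredLinearOrder 𝕊 renaming (Carrier to S)
    open EhrenfeuchtFraisse 𝕊
    open Game C (c <_) []

    Above : ∀ {N} → Vector S N → Set
    Above a = ∀ i → c < a i

    orderPredicates equalityPredicates colorPredicates atomicPredicates : ∀ N → List (Vector S N → Set)
    orderPredicates N = concat (tabulate λ i → tabulate λ j → λ a → a i < a j)
    equalityPredicates N = concat (tabulate λ i → tabulate λ j → λ a → a i ≡ a j)
    colorPredicates N = concat (map (λ col → tabulate λ i → λ a → U col (a i)) C)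
    atomicPredicates N = orderPredicates N ++ equalityPredicates N ++ colorPredicates N

    private
      All-table : ∀ {N} {Q : (Vector S N → Set) → Set} (f : Fin N → Fin N → Vector S N → Set) →
        All Q (concat (tabulate λ i → tabulate (f i))) → ∀ i j → Q (f i j)
      All-table f h i j = tabulate⁻ (tabulate⁻ (concat⁻ h) i) j

    atomicPredicates⇒AtomEquiv : ∀ {N} {a b : Vector S N} →
      All (λ f → f a ⇔ f b) (atomicPredicates N) → AtomEquiv a b
    atomicPredicates⇒AtomEquiv {N} {a} {b} h = record
      { <-⇔ = λ { (var i) (var j) _ _ → All-table (λ i j a → a i < a j) h< i j
                ; (var i) (param p) _ (() ∷ []) ; (param p) t (() ∷ []) _ }
      ; ≡-⇔ = λ { (var i) (var j) _ _ → All-table (λ i j a → a i ≡ a j) h≡ i j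
                ; (var i) (param p) _ (() ∷ []) ; (param p) t (() ∷ []) _ }
      ; U-⇔ = λ { col col∈C (var i) _ → tabulate⁻ (All-lookup (map⁻ (concat⁻ hU)) col∈C) i
                ; col col∈C (param p) (() ∷ []) }
      }
      where
      Agree : List (Vector S N → Set) → Set₁
      Agree = All (λ f → f a ⇔ f b)
      h< : Agree (orderPredicates N)
      h< = ++⁻ˡ (orderPredicates N) h
      h≡ : Agree (equalityPredicates N)
      h≡ = ++⁻ˡ (equalityPredicates N) (++⁻ʳ (orderPredicates N) h)
      hU : Agree (colorPredicates N)
      hU = ++⁻ʳ (equalityPredicates N) (++⁻ʳ (orderPredicates N) h)

    Reaches : ℕ → ∀ {N} → Vector S (suc N) → Vector S N → Set
    Reaches q t a = ∃[ x ] c < x × EF q (x ∷ᵥ a) t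

    -- A move from a lands in the class of some t ∈ L′, and b can reach that class too.
    classifiers⇒EF : ∀ q {N} (L′ : List (Vector S (suc N))) →
      (∀ t → Above t → ∃[ t′ ] t′ ∈ L′ × EF q t t′) → ∀ {a b} → Above a → Above b →
      All (λ f → f a ⇔ f b) (atomicPredicates N ++ map (Reaches q) L′) → EF (suc q) a b
    classifiers⇒EF q {N} L′ L′-covers {a} {b} c<a c<b same =
      atomicPredicates⇒AtomEquiv (++⁻ˡ (atomicPredicates N) same) , forth , back
      where
      sameReach : All (λ t → Reaches q t a ⇔ Reaches q t b) L′
      sameReach = map⁻ (++⁻ʳ (atomicPredicates N) same)
      forth : ∀ x → c < x → ∃[ y ] c < y × EF q (x ∷ᵥ a) (y ∷ᵥ b)
      forth x c<x =
        let t , t∈L′ , xa≈t = L′-covers (x ∷ᵥ a) (∷⁺ (c <_) c<x c<a)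
            y , c<y , yb≈t = to (All-lookup sameReach t∈L′) (x , c<x , xa≈t) in
        y , c<y , EF-trans q xa≈t (EF-sym q yb≈t)
      back : ∀ y → c < y → ∃[ x ] c < x × EF q (x ∷ᵥ a) (y ∷ᵥ b)
      back y c<y =
        let t , t∈L′ , yb≈t = L′-covers (y ∷ᵥ b) (∷⁺ (c <_) c<y c<b)
            x , c<x , xa≈t = from (All-lookup sameReach t∈L′) (y , c<y , yb≈t) in
        x , c<x , EF-trans q xa≈t (EF-sym q yb≈t)

    EF-finite-index : ∀ q N (X : Vector S N → Set) → (∀ a → X a → Above a) →
      ∃[ L ] All X L × (∀ a → X a → ∃[ b ] b ∈ L × EF q a b)
    EF-finite-index zero N X _ with representatives (atomicPredicates N) X
    ... | L , X-L , L-covers = L , X-L , λ a xa →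
      let b , b∈L , same = L-covers a xa in b , b∈L , atomicPredicates⇒AtomEquiv same
    EF-finite-index (suc q) N X X⊆Above with EF-finite-index q (suc N) Above (λ _ → id)
    ... | L′ , _ , L′-covers with representatives (atomicPredicates N ++ map (Reaches q) L′) X
    ... | L , X-L , L-covers = L , X-L , λ a xa →
      let b , b∈L , same = L-covers a xa in
      b , b∈L , classifiers⇒EF q L′ L′-covers (X⊆Above a xa) (X⊆Above b (All-lookup X-L b∈L)) same

module Fibres (𝕊 : ColoredLinearOrder) {n : ℕ}
  (D : ColoredLinearOrder.Carrier 𝕊 → Vector (ColoredLinearOrder.Carrier 𝕊) n → Set) where
  open ColoredLinearOrder 𝕊 renaming (Carrier to S)
  open Semantics 𝕊

  SameFibre : S → S → Set
  SameFibre r s = ∀ v → D r v ⇔ D s v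

  SameFibre-refl : ∀ {r} → SameFibre r r
  SameFibre-refl v = ⇔-refl

  SameFibre-sym : ∀ {r s} → SameFibre r s → SameFibre s r
  SameFibre-sym e v = ⇔-sym (e v)

  SameFibre-trans : ∀ {r s t} → SameFibre r s → SameFibre s t → SameFibre r t
  SameFibre-trans e e′ v = ⇔-trans (e v) (e′ v)

  ≥-definable : ∀ r₀ → Definable₁ 𝕊 (_≤_ 𝕊 r₀)
  ≥-definable r₀ = (param r₀ <ᶠ var fzero) ∨ᶠ (param r₀ ≈ᶠ var fzero) , λ _ → ⇔-refl

  ×-definable : (X Y : S → Set) → Definable₁ 𝕊 X → Definable₁ 𝕊 Y → Definable₁ 𝕊 (λ r → X r × Y r)
  ×-definable X Y (φ , hφ) (ψ , hψ) = φ ∧ᶠ ψ , λ v → hφ v ×-⇔ hψ v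

  SameFibre-definable : DefinableFamily 𝕊 n D → ∀ s → Definable₁ 𝕊 (λ r → SameFibre r s)
  SameFibre-definable (φ , hφ) s = ∀ⁿ n (sub atVar φ ⇔ᶠ sub atParam φ) , λ v →
    ⇔-sym (⇔-trans (Sat-∀ⁿ n _ v) (Π-cong-⇔ λ w →
      ⇔-trans (Sat-⇔ᶠ (sub atVar φ) (sub atParam φ) (w ++ᵥ v))
              (⇔-cong-⇔ (fibre atVar (atVar-⊨ w v)) (fibre atParam (atParam-⊨ w v)))))
    where
    atVar atParam : Substitution (suc n) (n + 1)
    atVar fzero = var (n ↑ʳ fzero)
    atVar (fsuc i) = var (i ↑ˡ 1)
    atParam fzero = param s
    atParam (fsuc i) = var (i ↑ˡ 1)

    atVar-⊨ : ∀ w v → (w ++ᵥ v) ⊨ₛ atVar ⇒ (v fzero ∷ᵥ w)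
    atVar-⊨ w v fzero = lookup-++ʳ w v fzero
    atVar-⊨ w v (fsuc i) = lookup-++ˡ w v i

    atParam-⊨ : ∀ w v → (w ++ᵥ v) ⊨ₛ atParam ⇒ (s ∷ᵥ w)
    atParam-⊨ w v fzero = refl
    atParam-⊨ w v (fsuc i) = lookup-++ˡ w v i

    fibre : ∀ σ {u r w} → u ⊨ₛ σ ⇒ (r ∷ᵥ w) → Sat 𝕊 (sub σ φ) u ⇔ D r w
    fibre σ {r = r} {w} e = ⇔-trans (Sat-sub σ φ e) (⇔-sym (hφ (r ∷ᵥ w)))

  FibrePartition : S → Set₁
  FibrePartition r₀ =
    Σ ℕ λ k →
    Σ (Fin k → S → Set) λ P →
      (∀ j → Definable₁ 𝕊 (P j))
      × (∀ j → Σ S (P j))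
      × (∀ j r → P j r → _≤_ 𝕊 r₀ r)
      × (∀ r → _≤_ 𝕊 r₀ r → Σ (Fin k) λ j → P j r)
      × (∀ j j′ r → P j r → P j′ r → j ≡ j′)
      × (∀ j r r′ → P j r → P j r′ → ∀ v → D r v ⇔ D r′ v)

  module _ (em : ExcludedMiddle 0ℓ) where

    distinctFibres : {Pr : S → Set} (L : List S) → All Pr L →
      ∃[ K ] (∀ j → Pr (lookup K j))
           × (∀ j j′ → SameFibre (lookup K j) (lookup K j′) → j ≡ j′)
           × (∀ y → y ∈ L → ∃[ j ] SameFibre y (lookup K j))
    distinctFibres [] [] = [] , (λ ()) , (λ ()) , (λ _ ())
    distinctFibres {Pr} (x ∷ xs) (px ∷ pxs) with distinctFibres xs pxs
    ... | K , Pr-K , K-distinct , K-covers with em {∃[ j ] SameFibre x (lookup K j)}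
    ... | yes (j , x≈Kj) = K , Pr-K , K-distinct , covers
      where
      covers : ∀ y → y ∈ x ∷ xs → ∃[ j ] SameFibre y (lookup K j)
      covers y (here refl) = j , x≈Kj
      covers y (there y∈xs) = K-covers y y∈xs
    ... | no x≉K = x ∷ K , Pr-xK , distinct , covers
      where
      Pr-xK : ∀ j → Pr (lookup (x ∷ K) j)
      Pr-xK fzero = px
      Pr-xK (fsuc j) = Pr-K j
      distinct : ∀ j j′ → SameFibre (lookup (x ∷ K) j) (lookup (x ∷ K) j′) → j ≡ j′
      distinct fzero fzero _ = refl
      distinct fzero (fsuc j′) e = ⊥-elim (x≉K (j′ , e))
      distinct (fsuc j) fzero e = ⊥-elim (x≉K (j , SameFibre-sym e))
      distinct (fsuc j) (fsuc j′) e = cong fsuc (K-distinct j j′ e)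
      covers : ∀ y → y ∈ x ∷ xs → ∃[ j ] SameFibre y (lookup (x ∷ K) j)
      covers y (here refl) = fzero , SameFibre-refl
      covers y (there y∈xs) = let j , e = K-covers y y∈xs in fsuc j , e

    fibrePartition : DefinableFamily 𝕊 n D → (r₀ : S) (L : List S) → All (_≤_ 𝕊 r₀) L →
      (∀ r → _≤_ 𝕊 r₀ r → ∃[ y ] y ∈ L × SameFibre r y) → FibrePartition r₀
    fibrePartition def r₀ L r₀≤L L-covers =
      let K , r₀≤K , K-distinct , K-covers = distinctFibres L r₀≤L in
      length K ,
      (λ j r → _≤_ 𝕊 r₀ r × SameFibre r (lookup K j)) ,
      (λ j → ×-definable (_≤_ 𝕊 r₀) (λ r → SameFibre r (lookup K j))
               (≥-definable r₀) (SameFibre-definable def (lookup K j))) ,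
      (λ j → lookup K j , r₀≤K j , SameFibre-refl) ,
      (λ j r → proj₁) ,
      (λ r r₀≤r → let y , y∈L , r≈y = L-covers r r₀≤r ; j , y≈Kj = K-covers y y∈L in
        j , r₀≤r , SameFibre-trans r≈y y≈Kj) ,
      (λ j j′ r (_ , r≈Kj) (_ , r≈Kj′) → K-distinct j j′ (SameFibre-trans (SameFibre-sym r≈Kj) r≈Kj′)) ,
      (λ j r r′ (_ , r≈Kj) (_ , r′≈Kj) → SameFibre-trans r≈Kj (SameFibre-sym r′≈Kj))

module FibreInvariance (𝕊 : ColoredLinearOrder) {n : ℕ}
  (D : ColoredLinearOrder.Carrier 𝕊 → Vector (ColoredLinearOrder.Carrier 𝕊) n → Set)
  (def : DefinableFamily 𝕊 n D) (c : ColoredLinearOrder.Carrier 𝕊)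
  (params≤c : All (λ p → _≤_ 𝕊 p c) (params 𝕊 (proj₁ def)))
  (D≤c : ∀ r v → D r v → ∀ i → _≤_ 𝕊 (v i) c) where
  open ColoredLinearOrder 𝕊 renaming (Carrier to S)
  open Order 𝕊
  open Semantics 𝕊
  open EhrenfeuchtFraisse 𝕊
  open Fibres 𝕊 D

  φ : Formula 𝕊 (suc n)
  φ = proj₁ def

  open Composition 𝕊 (colors φ) (params 𝕊 φ) c params≤c

  fibre-as-Sat : (a : Vector S 1) (v : Vector S n) → D (head a) v ⇔ Sat 𝕊 φ (a ++ᵥ v)
  fibre-as-Sat a v = ⇔-trans (proj₂ def (head a ∷ᵥ v)) (⇔-sym (Sat-cong φ (++-uncons a v)))

  EF⇒SameFibre : ∀ {a a′ : Vector S 1} → (∀ i → c < a i) → (∀ i → c < a′ i) →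
    R.EF (depth φ) a a′ → SameFibre (head a) (head a′)
  EF⇒SameFibre c<a c<a′ g v = mk⇔ (transfer c<a c<a′ g) (transfer c<a′ c<a (R.EF-sym (depth φ) g))
    where
    transfer : ∀ {a a′ : Vector S 1} → (∀ i → c < a i) → (∀ i → c < a′ i) →
      R.EF (depth φ) a a′ → D (head a) v → D (head a′) v
    transfer {a} {a′} c<a c<a′ g Dav = from (fibre-as-Sat a′ v)
      (to (EF-preserves-Sat (colors φ) (params 𝕊 φ) φ (All-tabulate id) (All-tabulate id) (depth φ) ≤-refl
            (EF-++ (depth φ) a a′ v c<a c<a′ (D≤c _ v Dav) g))
        (to (fibre-as-Sat a v) Dav))

  AtLeast : S → Vector S 1 → Set
  AtLeast x₀ a = _≤_ 𝕊 x₀ (head a)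

  AtLeast⇒Above : ∀ {x₀} → c < x₀ → ∀ a → AtLeast x₀ a → ∀ i → c < a i
  AtLeast⇒Above c<x₀ a x₀≤a fzero = <-≤-trans c<x₀ x₀≤a

  fibrePartitionAbove : ExcludedMiddle 0ℓ → Σ S FibrePartition
  fibrePartitionAbove em with em {∃[ x ] c < x}
  ... | no ∄x = c , fibrePartition em def c (c ∷ []) (inj₂ refl ∷ []) onlyC
    where
    onlyC : ∀ r → _≤_ 𝕊 c r → ∃[ y ] y ∈ c ∷ [] × SameFibre r y
    onlyC r (inj₁ c<r) = ⊥-elim (∄x (r , c<r))
    onlyC r (inj₂ refl) = r , here refl , SameFibre-refl
  ... | yes (x₀ , c<x₀)
    with FiniteIndex.EF-finite-index em 𝕊 (colors φ) c (depth φ) 1 (AtLeast x₀) (AtLeast⇒Above c<x₀)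
  ... | L , x₀≤L , L-covers = x₀ , fibrePartition em def x₀ (map head L) (map⁺ x₀≤L) covers
    where
    covers : ∀ r → _≤_ 𝕊 x₀ r → ∃[ y ] y ∈ map head L × SameFibre r y
    covers r x₀≤r =
      let b , b∈L , g = L-covers (r ∷ᵥ []ᵥ) x₀≤r in
      head b , ∈-map⁺ head b∈L ,
      EF⇒SameFibre (AtLeast⇒Above c<x₀ _ x₀≤r) (AtLeast⇒Above c<x₀ b (All-lookup x₀≤L b∈L)) g

proposition3p4 : ExcludedMiddle 0ℓ →
    (𝕊 : ColoredLinearOrder) → OmegaSaturated 𝕊 →
    (n : ℕ) (D : ColoredLinearOrder.Carrier 𝕊 → Vector (ColoredLinearOrder.Carrier 𝕊) n → Set) →
    DefinableFamily 𝕊 n D →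
    Σ (ColoredLinearOrder.Carrier 𝕊) (λ d → ∀ r v → D r v → ∀ i → ColoredLinearOrder._<_ 𝕊 (v i) d) →
    Σ (ColoredLinearOrder.Carrier 𝕊) λ r₀ →
    Σ ℕ λ k →
    Σ (Fin k → ColoredLinearOrder.Carrier 𝕊 → Set) λ P →
      (∀ j → Definable₁ 𝕊 (P j))
      × (∀ j → Σ (ColoredLinearOrder.Carrier 𝕊) (P j))
      × (∀ j r → P j r → _≤_ 𝕊 r₀ r)
      × (∀ r → _≤_ 𝕊 r₀ r → Σ (Fin k) λ j → P j r)
      × (∀ j j′ r → P j r → P j′ r → j ≡ j′)
      × (∀ j r r′ → P j r → P j r′ → ∀ v → D r v ⇔ D r′ v)
proposition3p4 em 𝕊 _ n D def (d , D<d) =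
  let c , d≤c , params≤c = upperBound d (params 𝕊 (proj₁ def)) in
  FibreInvariance.fibrePartitionAbove 𝕊 D def c params≤c
    (λ r v Drv i → inj₁ (<-≤-trans (D<d r v Drv i) d≤c)) em
  where open Order 𝕊
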